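{- Let $a,b,e$ be integers with $1\le e\le b$ and $a=2b+e$. Let $n=2m$ be even with $b\ge em$, and let $\varphi$ be an $(a,b)$-coloring of the path $P^n$ such that $\varphi(0)$ and $\varphi(n)$ are $n$-exactly-compatible. Then for every $k\in\{0,\ldots,n\}$: if $k=2s$ then $c(k)=(b-em,\ e(m-s),\ es,\ 0)$, and if $k=2s+1$ then $c(k)=(0,\ es,\ e(m-s-1),\ b-e(m-1))$.
   Context: An $(a,b)$-coloring of a graph assigns to each vertex a $b$-element subset of $\{1,\ldots,a\}$ so that adjacent vertices get disjoint sets. $P^n$ has vertices $0,\ldots,n$ and edges $i(i+1)$. A good set is a $b$-subset of $\{1,\ldots,a\}$. Good sets $X,Y$ are $k$-exactly-compatible if $|X\cap Y|=b-e\frac{k}{2}$ when $k$ is even and $|X\cap Y|=e\frac{k-1}{2}$ when $k$ is odd. With $C_0=\varphi(0)$, $C_n=\varphi(n)$ set $C(1)=C_0\cap C_n$, $C(2)=C_0\setminus C_n$, $C(3)=C_n\setminus C_0$, $C(4)=\{1,\ldots,a\}\setminus(C_0\cup C_n)$, and $c(j,k)=|\varphi(k)\cap C(j)|$, $c(k)=(c(1,k),c(2,k),c(3,k),c(4,k))$. -}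

module Defs where

open import Data.Nat using (ℕ; suc; _+_; _*_; _∸_)
open import Data.Bool using (Bool; true; false; not)
open import Data.Fin using (Fin; zero; suc; inject₁; fromℕ)
open import Data.Fin.Subset using (Subset; _∩_; _∪_; _─_; ∁; ∣_∣; ⊥)
open import Data.Product using (_×_; _,_)
open import Relation.Binary.PropositionalEquality using (_≡_)

-- An (a,b)-coloring of the path Pⁿ with vertices 0,…,n (= Fin (suc n))
-- and edges i(i+1): each vertex gets a b-element subset of {1,…,a}
-- (represented as a subset of Fin a), adjacent vertices get disjoint sets.
record IsColoring (a b n : ℕ) (φ : Fin (suc n) → Subset a) : Set where
  field
    good     : ∀ (i : Fin (suc n)) → ∣ φ i ∣ ≡ b
    disjoint : ∀ (i : Fin n) → φ (inject₁ i) ∩ φ (suc i) ≡ ⊥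

isEven : ℕ → Bool
isEven 0 = true
isEven (suc k) = not (isEven k)

half : ℕ → ℕ
half 0 = 0
half 1 = 0
half (suc (suc k)) = suc (half k)

exactTarget : ℕ → ℕ → ℕ → ℕ
exactTarget b e k with isEven k
... | true  = b ∸ e * half k
... | false = e * half k

ExactlyCompatible : ∀ {a} → (b e k : ℕ) → Subset a → Subset a → Set
ExactlyCompatible b e k X Y = ∣ X ∩ Y ∣ ≡ exactTarget b e k

module _ {a n : ℕ} (φ : Fin (suc n) → Subset a) where
  C₀ Cₙ : Subset a
  C₀ = φ zero
  Cₙ = φ (fromℕ n)

  C : Fin 4 → Subset a
  C zero = C₀ ∩ Cₙ
  C (suc zero) = C₀ ─ Cₙ
  C (suc (suc zero)) = Cₙ ─ C₀
  C (suc (suc (suc zero))) = ∁ (C₀ ∪ Cₙ)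

  -- c(j,k) = |φ(k) ∩ C(j)|   (j = 1..4 is Fin 4 index 0..3)
  c′ : Fin 4 → Fin (suc n) → ℕ
  c′ j k = ∣ φ k ∩ C j ∣

  c : Fin (suc n) → ℕ × ℕ × ℕ × ℕ
  c k = c′ zero k , c′ (suc zero) k , c′ (suc (suc zero)) k , c′ (suc (suc (suc zero))) k

-- Since a = 2b + e, two disjoint b-sets of colours leave exactly e colours unused, so φ(j) lies
-- inside φ(j+2) together with the e colours missed by both φ(j+1) and φ(j+2). Hence |φ(j) ∩ W|
-- and |φ(j+2) ∩ W| differ by at most e for every W. Walking in double steps from vertex 0 (where
-- |φ(0) ∩ C₀| = b and |φ(1) ∩ C₀| = 0) and from vertex n bounds c(1,k)+c(2,k) = |φ(k) ∩ C₀| and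
-- c(1,k)+c(3,k) = |φ(k) ∩ Cₙ| from below for even k and from above for odd k. Exact compatibility
-- gives |C(1)| = b − em and |C(4)| = e + b − em, and since c(1,k)+…+c(4,k) = b these bounds add up
-- to exactly b, so all of them are attained.
module Submission where

open import Defs

open import Data.Nat using (ℕ; zero; suc; _+_; _*_; _∸_; _≤_; _<_; z≤n; z<s; ∣_-_∣)
open import Data.Nat.Properties
open import Data.Nat.Tactic.RingSolver using (solve-∀)
open import Data.Fin using (Fin; zero; toℕ; fromℕ; fromℕ<; inject₁)
open import Data.Fin.Properties
  using (toℕ<n; toℕ-injective; toℕ-inject₁; toℕ-fromℕ; toℕ-fromℕ<; fromℕ<-toℕ; fromℕ<-cong; fromℕ-def)
open import Data.Fin.Subset using (Subset; _∩_; _∪_; _─_; ∁; ∣_∣; ⊥; _⊆_; _∈_; _∉_; inside; outside)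
open import Data.Fin.Subset.Properties
  using (x∈p∩q⁺; x∈p∩q⁻; x∈p∪q⁺; x∈p∪q⁻; x∉p⇒x∈∁p; ∉⊥; _∈?_; p⊆q⇒∣p∣≤∣q∣; ∣∁p∣≡n∸∣p∣; ∣p∣≤n;
         ∣⊥∣≡0; ∣p∩q∣≤∣q∣; ∩-comm; ∪-comm; ∩-idem)
open import Data.Bool using (true; not)
open import Data.Vec using ([]; _∷_)
open import Data.Product using (_×_; _,_)
open import Function using (_∘_)
open import Data.Sum using (inj₁; inj₂; [_,_])
open import Relation.Nullary using (yes; no)
open import Relation.Binary.PropositionalEquality
  using (_≡_; refl; sym; trans; cong; cong₂; subst; subst₂; module ≡-Reasoning)

∣p∪q∣+∣p∩q∣≡∣p∣+∣q∣ : ∀ {n} (p q : Subset n) → ∣ p ∪ q ∣ + ∣ p ∩ q ∣ ≡ ∣ p ∣ + ∣ q ∣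
∣p∪q∣+∣p∩q∣≡∣p∣+∣q∣ [] [] = refl
∣p∪q∣+∣p∩q∣≡∣p∣+∣q∣ (inside ∷ p) (inside ∷ q) = cong suc (begin
  ∣ p ∪ q ∣ + suc ∣ p ∩ q ∣ ≡⟨ +-suc _ _ ⟩
  suc (∣ p ∪ q ∣ + ∣ p ∩ q ∣) ≡⟨ cong suc (∣p∪q∣+∣p∩q∣≡∣p∣+∣q∣ p q) ⟩
  suc (∣ p ∣ + ∣ q ∣) ≡⟨ +-suc _ _ ⟨
  ∣ p ∣ + suc ∣ q ∣ ∎)
  where open ≡-Reasoning
∣p∪q∣+∣p∩q∣≡∣p∣+∣q∣ (inside ∷ p) (outside ∷ q) = cong suc (∣p∪q∣+∣p∩q∣≡∣p∣+∣q∣ p q)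
∣p∪q∣+∣p∩q∣≡∣p∣+∣q∣ (outside ∷ p) (inside ∷ q) =
  trans (cong suc (∣p∪q∣+∣p∩q∣≡∣p∣+∣q∣ p q)) (sym (+-suc _ _))
∣p∪q∣+∣p∩q∣≡∣p∣+∣q∣ (outside ∷ p) (outside ∷ q) = ∣p∪q∣+∣p∩q∣≡∣p∣+∣q∣ p q

∣p∪q∣≤∣p∣+∣q∣ : ∀ {n} (p q : Subset n) → ∣ p ∪ q ∣ ≤ ∣ p ∣ + ∣ q ∣
∣p∪q∣≤∣p∣+∣q∣ p q = subst (∣ p ∪ q ∣ ≤_) (∣p∪q∣+∣p∩q∣≡∣p∣+∣q∣ p q) (m≤m+n _ _)

∣∁p∣+∣p∣≡n : ∀ {n} (p : Subset n) → ∣ ∁ p ∣ + ∣ p ∣ ≡ n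
∣∁p∣+∣p∣≡n p = trans (cong (_+ ∣ p ∣) (∣∁p∣≡n∸∣p∣ p)) (m∸n+n≡m (∣p∣≤n p))

∣∁[p∪q]∣+[∣p∣+∣q∣]≡n+∣p∩q∣ : ∀ {n} (p q : Subset n) →
  ∣ ∁ (p ∪ q) ∣ + (∣ p ∣ + ∣ q ∣) ≡ n + ∣ p ∩ q ∣
∣∁[p∪q]∣+[∣p∣+∣q∣]≡n+∣p∩q∣ {n} p q = begin
  ∣ ∁ (p ∪ q) ∣ + (∣ p ∣ + ∣ q ∣)         ≡⟨ cong (∣ ∁ (p ∪ q) ∣ +_) (∣p∪q∣+∣p∩q∣≡∣p∣+∣q∣ p q) ⟨
  ∣ ∁ (p ∪ q) ∣ + (∣ p ∪ q ∣ + ∣ p ∩ q ∣) ≡⟨ +-assoc (∣ ∁ (p ∪ q) ∣) (∣ p ∪ q ∣) _ ⟨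
  ∣ ∁ (p ∪ q) ∣ + ∣ p ∪ q ∣ + ∣ p ∩ q ∣   ≡⟨ cong (_+ ∣ p ∩ q ∣) (∣∁p∣+∣p∣≡n (p ∪ q)) ⟩
  n + ∣ p ∩ q ∣                         ∎
  where open ≡-Reasoning

∣p∩q∣≡∣p∩[q∩r]∣+∣p∩[q─r]∣ : ∀ {n} (p q r : Subset n) → ∣ p ∩ q ∣ ≡ ∣ p ∩ (q ∩ r) ∣ + ∣ p ∩ (q ─ r) ∣
∣p∩q∣≡∣p∩[q∩r]∣+∣p∩[q─r]∣ [] [] [] = refl
∣p∩q∣≡∣p∩[q∩r]∣+∣p∩[q─r]∣ (outside ∷ p) (_ ∷ q) (_ ∷ r) = ∣p∩q∣≡∣p∩[q∩r]∣+∣p∩[q─r]∣ p q r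
∣p∩q∣≡∣p∩[q∩r]∣+∣p∩[q─r]∣ (inside ∷ p) (outside ∷ q) (inside ∷ r) = ∣p∩q∣≡∣p∩[q∩r]∣+∣p∩[q─r]∣ p q r
∣p∩q∣≡∣p∩[q∩r]∣+∣p∩[q─r]∣ (inside ∷ p) (outside ∷ q) (outside ∷ r) = ∣p∩q∣≡∣p∩[q∩r]∣+∣p∩[q─r]∣ p q r
∣p∩q∣≡∣p∩[q∩r]∣+∣p∩[q─r]∣ (inside ∷ p) (inside ∷ q) (inside ∷ r) =
  cong suc (∣p∩q∣≡∣p∩[q∩r]∣+∣p∩[q─r]∣ p q r)
∣p∩q∣≡∣p∩[q∩r]∣+∣p∩[q─r]∣ (inside ∷ p) (inside ∷ q) (outside ∷ r) =
  trans (cong suc (∣p∩q∣≡∣p∩[q∩r]∣+∣p∩[q─r]∣ p q r)) (sym (+-suc _ _))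

∣p∩r∣≡∣p∩[q∩r]∣+∣p∩[r─q]∣ : ∀ {n} (p q r : Subset n) → ∣ p ∩ r ∣ ≡ ∣ p ∩ (q ∩ r) ∣ + ∣ p ∩ (r ─ q) ∣
∣p∩r∣≡∣p∩[q∩r]∣+∣p∩[r─q]∣ p q r =
  trans (∣p∩q∣≡∣p∩[q∩r]∣+∣p∩[q─r]∣ p r q) (cong (λ x → ∣ p ∩ x ∣ + ∣ p ∩ (r ─ q) ∣) (∩-comm r q))

∣p∣≡∣p∩q∣+∣p∩[r─q]∣+∣p∩∁[q∪r]∣ : ∀ {n} (p q r : Subset n) →
  ∣ p ∣ ≡ ∣ p ∩ q ∣ + ∣ p ∩ (r ─ q) ∣ + ∣ p ∩ ∁ (q ∪ r) ∣
∣p∣≡∣p∩q∣+∣p∩[r─q]∣+∣p∩∁[q∪r]∣ [] [] [] = refl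
∣p∣≡∣p∩q∣+∣p∩[r─q]∣+∣p∩∁[q∪r]∣ (outside ∷ p) (_ ∷ q) (_ ∷ r) = ∣p∣≡∣p∩q∣+∣p∩[r─q]∣+∣p∩∁[q∪r]∣ p q r
∣p∣≡∣p∩q∣+∣p∩[r─q]∣+∣p∩∁[q∪r]∣ (inside ∷ p) (inside ∷ q) (_ ∷ r) =
  cong suc (∣p∣≡∣p∩q∣+∣p∩[r─q]∣+∣p∩∁[q∪r]∣ p q r)
∣p∣≡∣p∩q∣+∣p∩[r─q]∣+∣p∩∁[q∪r]∣ (inside ∷ p) (outside ∷ q) (inside ∷ r) =
  trans (cong suc (∣p∣≡∣p∩q∣+∣p∩[r─q]∣+∣p∩∁[q∪r]∣ p q r))
        (cong (_+ ∣ p ∩ ∁ (q ∪ r) ∣) (sym (+-suc (∣ p ∩ q ∣) (∣ p ∩ (r ─ q) ∣))))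
∣p∣≡∣p∩q∣+∣p∩[r─q]∣+∣p∩∁[q∪r]∣ (inside ∷ p) (outside ∷ q) (outside ∷ r) =
  trans (cong suc (∣p∣≡∣p∩q∣+∣p∩[r─q]∣+∣p∩∁[q∪r]∣ p q r)) (sym (+-suc _ _))

∣p∣≡∣p∩[q∩r]∣+∣p∩[q─r]∣+∣p∩[r─q]∣+∣p∩∁[q∪r]∣ : ∀ {n} (p q r : Subset n) →
  ∣ p ∣ ≡ ∣ p ∩ (q ∩ r) ∣ + ∣ p ∩ (q ─ r) ∣ + ∣ p ∩ (r ─ q) ∣ + ∣ p ∩ ∁ (q ∪ r) ∣
∣p∣≡∣p∩[q∩r]∣+∣p∩[q─r]∣+∣p∩[r─q]∣+∣p∩∁[q∪r]∣ p q r =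
  trans (∣p∣≡∣p∩q∣+∣p∩[r─q]∣+∣p∩∁[q∪r]∣ p q r)
        (cong (λ x → x + ∣ p ∩ (r ─ q) ∣ + ∣ p ∩ ∁ (q ∪ r) ∣) (∣p∩q∣≡∣p∩[q∩r]∣+∣p∩[q─r]∣ p q r))

p∩q≡⊥⇒p∩w⊆r∩w∪∁[q∪r] : ∀ {n} {p q : Subset n} (r w : Subset n) → p ∩ q ≡ ⊥ →
  p ∩ w ⊆ (r ∩ w) ∪ ∁ (q ∪ r)
p∩q≡⊥⇒p∩w⊆r∩w∪∁[q∪r] {p = p} {q} r w p∩q≡⊥ {x} x∈p∩w with x∈p∩q⁻ p w x∈p∩w | x ∈? r
... | x∈p , x∈w | yes x∈r = x∈p∪q⁺ (inj₁ (x∈p∩q⁺ (x∈r , x∈w)))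
... | x∈p , _   | no x∉r  = x∈p∪q⁺ (inj₂ (x∉p⇒x∈∁p x∉q∪r))
  where
  x∉q∪r : x ∉ q ∪ r
  x∉q∪r = [ (λ x∈q → ∉⊥ (subst (x ∈_) p∩q≡⊥ (x∈p∩q⁺ (x∈p , x∈q)))) , x∉r ] ∘ x∈p∪q⁻ q r

p∩q≡⊥⇒∣p∩w∣≤∣r∩w∣+∣∁[q∪r]∣ : ∀ {n} {p q : Subset n} (r w : Subset n) → p ∩ q ≡ ⊥ →
  ∣ p ∩ w ∣ ≤ ∣ r ∩ w ∣ + ∣ ∁ (q ∪ r) ∣
p∩q≡⊥⇒∣p∩w∣≤∣r∩w∣+∣∁[q∪r]∣ {q = q} r w p∩q≡⊥ =
  ≤-trans (p⊆q⇒∣p∣≤∣q∣ (p∩q≡⊥⇒p∩w⊆r∩w∪∁[q∪r] r w p∩q≡⊥)) (∣p∪q∣≤∣p∣+∣q∣ (r ∩ w) (∁ (q ∪ r)))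

m≤n+o⇒n≤m+o⇒∣m-n∣≤o : ∀ {m n o} → m ≤ n + o → n ≤ m + o → ∣ m - n ∣ ≤ o
m≤n+o⇒n≤m+o⇒∣m-n∣≤o {m} {n} m≤n+o n≤m+o with ∣m-n∣≡[m∸n]∨[n∸m] m n
... | inj₁ ∣m-n∣≡m∸n = subst (_≤ _) (sym ∣m-n∣≡m∸n) (m≤n+o⇒m∸n≤o m n m≤n+o)
... | inj₂ ∣m-n∣≡n∸m = subst (_≤ _) (sym ∣m-n∣≡n∸m) (m≤n+o⇒m∸n≤o n m n≤m+o)

∣m-n∣≤o⇒m≤n+o : ∀ {m n o} → ∣ m - n ∣ ≤ o → m ≤ n + o
∣m-n∣≤o⇒m≤n+o {m} {n} ∣m-n∣≤o = ≤-trans (m≤n+∣m-n∣ m n) (+-monoʳ-≤ n ∣m-n∣≤o)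

∣m-n∣≤o⇒n≤m+o : ∀ {m n o} → ∣ m - n ∣ ≤ o → n ≤ m + o
∣m-n∣≤o⇒n≤m+o {m} {n} ∣m-n∣≤o = ≤-trans (m≤n+∣n-m∣ n m) (+-monoʳ-≤ m ∣m-n∣≤o)

+-squeeze : ∀ {m n o p} → m ≤ o → n ≤ p → m + n ≡ o + p → m ≡ o × n ≡ p
+-squeeze {m} {n} {o} {p} m≤o n≤p m+n≡o+p =
  m≡o , +-cancelˡ-≡ o n p (subst (λ x → x + n ≡ o + p) m≡o m+n≡o+p)
  where
  m≡o : m ≡ o
  m≡o = ≤-antisym m≤o (+-cancelʳ-≤ p o m (≤-trans (≤-reflexive (sym m+n≡o+p)) (+-monoʳ-≤ m n≤p)))

squeeze₄ : ∀ {x y z w u v o} → x + y ≤ u → x + z ≤ v → w ≤ o → x + y + z + w ≡ u + v + o →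
  (x , y , z , w) ≡ (0 , u , v , o)
squeeze₄ {x} {y} {z} {w} {u} {v} {o} x+y≤u x+z≤v w≤o total with x≡0
  where
  -- counting x twice in (x + y) + (x + z) + w leaves no room for it
  x≡0 : x ≡ 0
  x≡0 = n≤0⇒n≡0 (+-cancelʳ-≤ (x + y + z + w) x 0 (begin
    x + (x + y + z + w)     ≡⟨ regroup x y z w ⟩
    x + y + (x + z) + w     ≤⟨ +-mono-≤ (+-mono-≤ x+y≤u x+z≤v) w≤o ⟩
    u + v + o               ≡⟨ total ⟨
    x + y + z + w           ∎))
    where
    open ≤-Reasoning
    regroup : ∀ x y z w → x + (x + y + z + w) ≡ x + y + (x + z) + w
    regroup = solve-∀
... | refl with +-squeeze (+-mono-≤ x+y≤u x+z≤v) w≤o total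
... | y+z≡u+v , refl with +-squeeze x+y≤u x+z≤v y+z≡u+v
... | refl , refl = refl

squeeze₄-lower : ∀ {b x y z w u v r} → b ≡ u + v + r → x + y + z + w ≡ b → x ≤ r →
  b ≤ x + y + u → b ≤ x + z + v → (x , y , z , w) ≡ (r , v , u , 0)
squeeze₄-lower {x = x} {y} {z} {w} {u} {v} {r} refl total x≤r b≤x+y+u b≤x+z+v
  with squeeze₄ {w} {z} {y} {x} w+z≤u w+y≤v x≤r (trans (regroup₃ x y z w) total)
  where
  regroup₁ : ∀ x y z w → x + y + z + w ≡ x + y + (w + z)
  regroup₁ = solve-∀
  regroup₂ : ∀ x y z w → x + y + z + w ≡ x + z + (w + y)
  regroup₂ = solve-∀
  regroup₃ : ∀ x y z w → w + z + y + x ≡ x + y + z + w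
  regroup₃ = solve-∀
  w+z≤u : w + z ≤ u
  w+z≤u = +-cancelˡ-≤ (x + y) (w + z) u
    (subst (_≤ x + y + u) (trans (sym total) (regroup₁ x y z w)) b≤x+y+u)
  w+y≤v : w + y ≤ v
  w+y≤v = +-cancelˡ-≤ (x + z) (w + y) v
    (subst (_≤ x + z + v) (trans (sym total) (regroup₂ x y z w)) b≤x+z+v)
... | refl = refl

isEven-2* : ∀ m → isEven (2 * m) ≡ true
isEven-2* zero = refl
isEven-2* (suc m) = trans (cong isEven (*-suc 2 m)) (cong (λ x → not (not x)) (isEven-2* m))

half-2* : ∀ m → half (2 * m) ≡ m
half-2* zero = refl
half-2* (suc m) = trans (cong half (*-suc 2 m)) (cong suc (half-2* m))

exactTarget-2* : ∀ b e m → exactTarget b e (2 * m) ≡ b ∸ e * m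
exactTarget-2* b e m rewrite isEven-2* m | half-2* m = refl

module PathColoring {a b e n : ℕ} {φ : Fin (suc n) → Subset a}
                    (coloring : IsColoring a b n φ) (a≡2b+e : a ≡ 2 * b + e) where

  open IsColoring coloring

  ∣∁[p∪q]∣≡e+∣p∩q∣ : ∀ (p q : Subset a) → ∣ p ∣ ≡ b → ∣ q ∣ ≡ b → ∣ ∁ (p ∪ q) ∣ ≡ e + ∣ p ∩ q ∣
  ∣∁[p∪q]∣≡e+∣p∩q∣ p q ∣p∣≡b ∣q∣≡b = +-cancelʳ-≡ (b + b) _ _ (begin
    ∣ ∁ (p ∪ q) ∣ + (b + b)         ≡⟨ cong (∣ ∁ (p ∪ q) ∣ +_) (sym (cong₂ _+_ ∣p∣≡b ∣q∣≡b)) ⟩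
    ∣ ∁ (p ∪ q) ∣ + (∣ p ∣ + ∣ q ∣) ≡⟨ ∣∁[p∪q]∣+[∣p∣+∣q∣]≡n+∣p∩q∣ p q ⟩
    a + ∣ p ∩ q ∣                   ≡⟨ cong (_+ ∣ p ∩ q ∣) a≡2b+e ⟩
    2 * b + e + ∣ p ∩ q ∣           ≡⟨ regroup b e (∣ p ∩ q ∣) ⟩
    e + ∣ p ∩ q ∣ + (b + b)         ∎)
    where
    open ≡-Reasoning
    regroup : ∀ b e i → 2 * b + e + i ≡ e + i + (b + b)
    regroup = solve-∀

  vertex : (j : ℕ) → .(j < suc n) → Subset a
  vertex j j≤n = φ (fromℕ< j≤n)

  vertex-cong : ∀ {i j} → i ≡ j → .(i≤n : i < suc n) .(j≤n : j < suc n) → vertex i i≤n ≡ vertex j j≤n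
  vertex-cong {i} {j} i≡j i≤n j≤n = cong φ (fromℕ<-cong i j i≡j i≤n j≤n)

  vertex-disjoint : ∀ j (j≤n : j < suc n) (1+j≤n : suc j < suc n) →
    vertex j j≤n ∩ vertex (suc j) 1+j≤n ≡ ⊥
  vertex-disjoint j j≤n 1+j≤n =
    subst (λ i → φ i ∩ vertex (suc j) 1+j≤n ≡ ⊥) inject₁-fromℕ< (disjoint (fromℕ< (≤-pred 1+j≤n)))
    where
    inject₁-fromℕ< : inject₁ (fromℕ< (≤-pred 1+j≤n)) ≡ fromℕ< j≤n
    inject₁-fromℕ< = toℕ-injective
      (trans (toℕ-inject₁ _) (trans (toℕ-fromℕ< (≤-pred 1+j≤n)) (sym (toℕ-fromℕ< j≤n))))

  ∣∁[vertex∪vertex]∣≡e : ∀ j (j≤n : j < suc n) (1+j≤n : suc j < suc n) →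
    ∣ ∁ (vertex j j≤n ∪ vertex (suc j) 1+j≤n) ∣ ≡ e
  ∣∁[vertex∪vertex]∣≡e j j≤n 1+j≤n = begin
    ∣ ∁ (vertex j j≤n ∪ vertex (suc j) 1+j≤n) ∣
      ≡⟨ ∣∁[p∪q]∣≡e+∣p∩q∣ (vertex j j≤n) (vertex (suc j) 1+j≤n) (good _) (good _) ⟩
    e + ∣ vertex j j≤n ∩ vertex (suc j) 1+j≤n ∣ ≡⟨ cong (λ p → e + ∣ p ∣) (vertex-disjoint j j≤n 1+j≤n) ⟩
    e + ∣ ⊥ {n = a} ∣                           ≡⟨ cong (e +_) (∣⊥∣≡0 a) ⟩
    e + 0                                       ≡⟨ +-identityʳ e ⟩
    e                                           ∎
    where open ≡-Reasoning

  two-step : ∀ j (j≤n : j < suc n) (1+j≤n : suc j < suc n) (2+j≤n : suc (suc j) < suc n)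
    (w : Subset a) → ∣ ∣ vertex j j≤n ∩ w ∣ - ∣ vertex (suc (suc j)) 2+j≤n ∩ w ∣ ∣ ≤ e
  two-step j j≤n 1+j≤n 2+j≤n w = m≤n+o⇒n≤m+o⇒∣m-n∣≤o
    (subst (λ d → ∣ X ∩ w ∣ ≤ ∣ Z ∩ w ∣ + d) (∣∁[vertex∪vertex]∣≡e (suc j) 1+j≤n 2+j≤n)
      (p∩q≡⊥⇒∣p∩w∣≤∣r∩w∣+∣∁[q∪r]∣ Z w (vertex-disjoint j j≤n 1+j≤n)))
    (subst (λ d → ∣ Z ∩ w ∣ ≤ ∣ X ∩ w ∣ + d)
      (trans (cong (λ p → ∣ ∁ p ∣) (∪-comm Y X)) (∣∁[vertex∪vertex]∣≡e j j≤n 1+j≤n))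
        (p∩q≡⊥⇒∣p∩w∣≤∣r∩w∣+∣∁[q∪r]∣ X w
        (trans (∩-comm Z Y) (vertex-disjoint (suc j) 1+j≤n 2+j≤n))))
    where
    X Y Z : Subset a
    X = vertex j j≤n
    Y = vertex (suc j) 1+j≤n
    Z = vertex (suc (suc j)) 2+j≤n

  vertex-drift : ∀ t {i j} → i + 2 * t ≡ j → (i≤n : i < suc n) (j≤n : j < suc n) (w : Subset a) →
    ∣ ∣ vertex i i≤n ∩ w ∣ - ∣ vertex j j≤n ∩ w ∣ ∣ ≤ e * t
  vertex-drift zero {i} i+0≡j i≤n j≤n w = ≤-trans
    (≤-reflexive (m≡n⇒∣m-n∣≡0
      (cong (λ p → ∣ p ∩ w ∣) (vertex-cong (trans (sym (+-identityʳ i)) i+0≡j) i≤n j≤n))))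
    z≤n
  vertex-drift (suc t) {i} {j} i+2[1+t]≡j i≤n j≤n w = begin
    ∣ x - z ∣             ≤⟨ ∣-∣-triangle x y z ⟩
    ∣ x - y ∣ + ∣ y - z ∣ ≤⟨ +-mono-≤ (two-step i i≤n 1+i≤n 2+i≤n w)
                                      (vertex-drift t 2+i+2t≡j 2+i≤n j≤n w) ⟩
    e + e * t             ≡⟨ *-suc e t ⟨
    e * suc t             ∎
    where
    open ≤-Reasoning
    regroup : ∀ i t → suc (suc i) + 2 * t ≡ i + 2 * suc t
    regroup = solve-∀
    2+i+2t≡j : suc (suc i) + 2 * t ≡ j
    2+i+2t≡j = trans (regroup i t) i+2[1+t]≡j
    2+i≤n : suc (suc i) < suc n
    2+i≤n = ≤-<-trans (m≤m+n (suc (suc i)) (2 * t)) (subst (_< suc n) (sym 2+i+2t≡j) j≤n)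
    1+i≤n : suc i < suc n
    1+i≤n = <-trans (n<1+n (suc i)) 2+i≤n
    x y z : ℕ
    x = ∣ vertex i i≤n ∩ w ∣
    y = ∣ vertex (suc (suc i)) 2+i≤n ∩ w ∣
    z = ∣ vertex j j≤n ∩ w ∣

  φ-drift : ∀ t (k l : Fin (suc n)) → toℕ k + 2 * t ≡ toℕ l → (w : Subset a) →
    ∣ ∣ φ k ∩ w ∣ - ∣ φ l ∩ w ∣ ∣ ≤ e * t
  φ-drift t k l k+2t≡l w = subst₂ (λ p q → ∣ ∣ p ∩ w ∣ - ∣ q ∩ w ∣ ∣ ≤ e * t)
    (cong φ (fromℕ<-toℕ k (toℕ<n k))) (cong φ (fromℕ<-toℕ l (toℕ<n l)))
    (vertex-drift t k+2t≡l (toℕ<n k) (toℕ<n l) w)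

  ∣φ∩φ∣≡b : ∀ k → ∣ φ k ∩ φ k ∣ ≡ b
  ∣φ∩φ∣≡b k = trans (cong ∣_∣ (∩-idem (φ k))) (good k)

  ∣φ∩C₀∣-lower : ∀ k s → toℕ k ≡ 2 * s → b ≤ ∣ φ k ∩ C₀ φ ∣ + e * s
  ∣φ∩C₀∣-lower k s k≡2s = subst (_≤ ∣ φ k ∩ C₀ φ ∣ + e * s) (∣φ∩φ∣≡b zero)
    (∣m-n∣≤o⇒m≤n+o (φ-drift s zero k (sym k≡2s) (C₀ φ)))

  ∣φ∩Cₙ∣-lower : ∀ k t → toℕ k + 2 * t ≡ n → b ≤ ∣ φ k ∩ Cₙ φ ∣ + e * t
  ∣φ∩Cₙ∣-lower k t k+2t≡n = subst (_≤ ∣ φ k ∩ Cₙ φ ∣ + e * t) (∣φ∩φ∣≡b (fromℕ n))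
    (∣m-n∣≤o⇒n≤m+o (φ-drift t k (fromℕ n) (trans k+2t≡n (sym (toℕ-fromℕ n))) (Cₙ φ)))

  ∣φ∩C₀∣-upper : ∀ k s → toℕ k ≡ 2 * s + 1 → ∣ φ k ∩ C₀ φ ∣ ≤ e * s
  ∣φ∩C₀∣-upper k s k≡2s+1 = subst (λ x → ∣ φ k ∩ C₀ φ ∣ ≤ x + e * s) ∣φ₁∩φ₀∣≡0
    (∣m-n∣≤o⇒n≤m+o (φ-drift s (fromℕ< 1≤n) k 1+2s≡k (C₀ φ)))
    where
    1≤n : 1 < suc n
    1≤n = ≤-<-trans (m≤n+m 1 (2 * s)) (subst (_< suc n) k≡2s+1 (toℕ<n k))
    1+2s≡k : toℕ (fromℕ< 1≤n) + 2 * s ≡ toℕ k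
    1+2s≡k = trans (cong (_+ 2 * s) (toℕ-fromℕ< 1≤n)) (trans (+-comm 1 (2 * s)) (sym k≡2s+1))
    ∣φ₁∩φ₀∣≡0 : ∣ vertex 1 1≤n ∩ vertex 0 z<s ∣ ≡ 0
    ∣φ₁∩φ₀∣≡0 = trans (cong ∣_∣ (trans (∩-comm _ _) (vertex-disjoint 0 z<s 1≤n))) (∣⊥∣≡0 a)

  ∣φ∩Cₙ∣-upper : ∀ k t → toℕ k + 2 * t + 1 ≡ n → ∣ φ k ∩ Cₙ φ ∣ ≤ e * t
  ∣φ∩Cₙ∣-upper k t k+2t+1≡n = subst (λ x → ∣ φ k ∩ Cₙ φ ∣ ≤ x + e * t) ∣φⱼ∩φₙ∣≡0
    (∣m-n∣≤o⇒m≤n+o (φ-drift t k (fromℕ< j≤n) (sym (toℕ-fromℕ< j≤n)) (Cₙ φ)))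
    where
    j : ℕ
    j = toℕ k + 2 * t
    1+j≡n : suc j ≡ n
    1+j≡n = trans (+-comm 1 j) k+2t+1≡n
    1+j≤n : suc j < suc n
    1+j≤n = subst (_< suc n) (sym 1+j≡n) (n<1+n n)
    j≤n : j < suc n
    j≤n = <-trans (n<1+n j) 1+j≤n
    ∣φⱼ∩φₙ∣≡0 : ∣ vertex j j≤n ∩ Cₙ φ ∣ ≡ 0
    ∣φⱼ∩φₙ∣≡0 = begin
      ∣ vertex j j≤n ∩ φ (fromℕ n) ∣           ≡⟨ cong (λ i → ∣ vertex j j≤n ∩ φ i ∣) (fromℕ-def n) ⟩
      ∣ vertex j j≤n ∩ vertex n (n<1+n n) ∣
        ≡⟨ cong (λ p → ∣ vertex j j≤n ∩ p ∣) (vertex-cong 1+j≡n 1+j≤n (n<1+n n)) ⟨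
      ∣ vertex j j≤n ∩ vertex (suc j) 1+j≤n ∣   ≡⟨ cong ∣_∣ (vertex-disjoint j j≤n 1+j≤n) ⟩
      ∣ ⊥ {n = a} ∣                             ≡⟨ ∣⊥∣≡0 a ⟩
      0                                         ∎
      where open ≡-Reasoning

  ∣φ∣≡c₁+c₂+c₃+c₄ : ∀ k → ∣ φ k ∩ (C₀ φ ∩ Cₙ φ) ∣ + ∣ φ k ∩ (C₀ φ ─ Cₙ φ) ∣ + ∣ φ k ∩ (Cₙ φ ─ C₀ φ) ∣
                           + ∣ φ k ∩ ∁ (C₀ φ ∪ Cₙ φ) ∣ ≡ b
  ∣φ∣≡c₁+c₂+c₃+c₄ k =
    trans (sym (∣p∣≡∣p∩[q∩r]∣+∣p∩[q─r]∣+∣p∩[r─q]∣+∣p∩∁[q∪r]∣ (φ k) (C₀ φ) (Cₙ φ))) (good k)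

  even-profile : ∀ m → n ≡ 2 * m → e * m ≤ b → ∣ C₀ φ ∩ Cₙ φ ∣ ≡ b ∸ e * m →
    ∀ k s → toℕ k ≡ 2 * s → c φ k ≡ (b ∸ e * m , e * (m ∸ s) , e * s , 0)
  even-profile m n≡2m em≤b ∣C₀∩Cₙ∣≡r k s k≡2s with m≤n⇒∃[o]m+o≡n s≤m
    where
    s≤m : s ≤ m
    s≤m = *-cancelˡ-≤ 2 (subst₂ _≤_ k≡2s n≡2m (≤-pred (toℕ<n k)))
  ... | t , refl rewrite m+n∸m≡n s t =
    squeeze₄-lower b≡es+et+r (∣φ∣≡c₁+c₂+c₃+c₄ k) c₁≤r
      (subst (λ x → b ≤ x + e * s) (∣p∩q∣≡∣p∩[q∩r]∣+∣p∩[q─r]∣ (φ k) (C₀ φ) (Cₙ φ))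
        (∣φ∩C₀∣-lower k s k≡2s))
      (subst (λ x → b ≤ x + e * t) (∣p∩r∣≡∣p∩[q∩r]∣+∣p∩[r─q]∣ (φ k) (C₀ φ) (Cₙ φ))
        (∣φ∩Cₙ∣-lower k t k+2t≡n))
    where
    r : ℕ
    r = b ∸ e * (s + t)
    b≡es+et+r : b ≡ e * s + e * t + r
    b≡es+et+r = trans (sym (m+[n∸m]≡n em≤b)) (cong (_+ r) (*-distribˡ-+ e s t))
    c₁≤r : ∣ φ k ∩ (C₀ φ ∩ Cₙ φ) ∣ ≤ r
    c₁≤r = subst (∣ φ k ∩ (C₀ φ ∩ Cₙ φ) ∣ ≤_) ∣C₀∩Cₙ∣≡r (∣p∩q∣≤∣q∣ (φ k) (C₀ φ ∩ Cₙ φ))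
    k+2t≡n : toℕ k + 2 * t ≡ n
    k+2t≡n = trans (cong (_+ 2 * t) k≡2s) (trans (sym (*-distribˡ-+ 2 s t)) (sym n≡2m))

  odd-profile : ∀ m → n ≡ 2 * m → e * m ≤ b → ∣ C₀ φ ∩ Cₙ φ ∣ ≡ b ∸ e * m →
    ∀ k s → toℕ k ≡ 2 * s + 1 → c φ k ≡ (0 , e * s , e * (m ∸ s ∸ 1) , b ∸ e * (m ∸ 1))
  odd-profile m n≡2m em≤b ∣C₀∩Cₙ∣≡r k s k≡2s+1 with m≤n⇒∃[o]m+o≡n s<m
    where
    s<m : s < m
    s<m = *-cancelˡ-< 2 s m
      (subst₂ _≤_ (trans k≡2s+1 (+-comm (2 * s) 1)) n≡2m (≤-pred (toℕ<n k)))
  ... | t , refl rewrite ∸-+-assoc (suc s + t) s 1 | +-comm s 1 | m+n∸m≡n (suc s) t =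
    squeeze₄
      (subst (_≤ e * s) (∣p∩q∣≡∣p∩[q∩r]∣+∣p∩[q─r]∣ (φ k) (C₀ φ) (Cₙ φ))
        (∣φ∩C₀∣-upper k s k≡2s+1))
      (subst (_≤ e * t) (∣p∩r∣≡∣p∩[q∩r]∣+∣p∩[r─q]∣ (φ k) (C₀ φ) (Cₙ φ))
        (∣φ∩Cₙ∣-upper k t k+2t+1≡n))
      (subst (∣ φ k ∩ ∁ (C₀ φ ∪ Cₙ φ) ∣ ≤_) (sym b∸e[s+t]≡e+r) c₄≤e+r)
      (trans (∣φ∣≡c₁+c₂+c₃+c₄ k)
        (trans b≡es+et+[e+r] (cong (e * s + e * t +_) (sym b∸e[s+t]≡e+r))))
    where
    r : ℕ
    r = b ∸ e * suc (s + t)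
    b≡es+et+[e+r] : b ≡ e * s + e * t + (e + r)
    b≡es+et+[e+r] = trans (sym (m+[n∸m]≡n em≤b)) (regroup e s t r)
      where
      regroup : ∀ e s t r → e * suc (s + t) + r ≡ e * s + e * t + (e + r)
      regroup = solve-∀
    b∸e[s+t]≡e+r : b ∸ e * (s + t) ≡ e + r
    b∸e[s+t]≡e+r = begin
      b ∸ e * (s + t)                     ≡⟨ cong (_∸ e * (s + t)) b≡es+et+[e+r] ⟩
      e * s + e * t + (e + r) ∸ e * (s + t)
        ≡⟨ cong (λ x → x + (e + r) ∸ e * (s + t)) (*-distribˡ-+ e s t) ⟨
      e * (s + t) + (e + r) ∸ e * (s + t) ≡⟨ m+n∸m≡n (e * (s + t)) (e + r) ⟩
      e + r                               ∎
      where open ≡-Reasoning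
    c₄≤e+r : ∣ φ k ∩ ∁ (C₀ φ ∪ Cₙ φ) ∣ ≤ e + r
    c₄≤e+r = subst (∣ φ k ∩ ∁ (C₀ φ ∪ Cₙ φ) ∣ ≤_)
      (trans (∣∁[p∪q]∣≡e+∣p∩q∣ (C₀ φ) (Cₙ φ) (good zero) (good (fromℕ n)))
             (cong (e +_) ∣C₀∩Cₙ∣≡r))
      (∣p∩q∣≤∣q∣ (φ k) (∁ (C₀ φ ∪ Cₙ φ)))
    k+2t+1≡n : toℕ k + 2 * t + 1 ≡ n
    k+2t+1≡n = trans (cong (λ x → x + 2 * t + 1) k≡2s+1) (trans (regroup s t) (sym n≡2m))
      where
      regroup : ∀ s t → 2 * s + 1 + 2 * t + 1 ≡ 2 * (suc s + t)
      regroup = solve-∀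

proposition3 : (a b e : ℕ) → 1 ≤ e → e ≤ b → a ≡ 2 * b + e →
    (n m : ℕ) → n ≡ 2 * m → e * m ≤ b →
    (φ : Fin (suc n) → Subset a) → IsColoring a b n φ →
    ExactlyCompatible b e n (φ zero) (φ (fromℕ n)) →
    (k : Fin (suc n)) →
      (∀ s → toℕ k ≡ 2 * s → c φ k ≡ (b ∸ e * m , e * (m ∸ s) , e * s , 0)) ×
      (∀ s → toℕ k ≡ 2 * s + 1 → c φ k ≡ (0 , e * s , e * (m ∸ s ∸ 1) , b ∸ e * (m ∸ 1)))
proposition3 a b e _ _ a≡2b+e n m n≡2m em≤b φ coloring compatible k =
  even-profile m n≡2m em≤b ∣C₀∩Cₙ∣≡b∸em k , odd-profile m n≡2m em≤b ∣C₀∩Cₙ∣≡b∸em k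
  where
  open PathColoring coloring a≡2b+e
  ∣C₀∩Cₙ∣≡b∸em : ∣ C₀ φ ∩ Cₙ φ ∣ ≡ b ∸ e * m
  ∣C₀∩Cₙ∣≡b∸em = trans compatible (trans (cong (exactTarget b e) n≡2m) (exactTarget-2* b e m))
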